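{- Let $\mathcal{B}(2)=\{(b,a)\in\mathbb{Z}^2: 0\le b<a\}$ and for $r\ge 2$ let $\mathcal{B}_r(2)=\{(b,a)\in\mathcal{B}(2): a\le r\}$, with weight $\mathrm{wt}_r(b,a)=r-a-b$. Define $F:\mathcal{B}(2)\to\mathcal{B}(2)$ by $F(b,a)=(b+1,a)$ if $a\equiv b \pmod 2$ and $F(b,a)=(b,a+1)$ if $a\not\equiv b\pmod 2$. For $r\ge2$ define $F_r:\mathcal{B}_r(2)\to\mathcal{B}_r(2)\cup\{0\}$ by $F_r(t)=F(t)$ if $F(t)\in\mathcal{B}_r(2)$ and $F_r(t)=0$ otherwise. Then for every $r\ge 2$, $(\mathcal{B}_r(2),F_r,\mathrm{wt}_r)$ is a crystal.
   Context: A crystal is a set $\mathcal{B}$ with maps $F:\mathcal{B}\to\mathcal{B}\cup\{0\}$ and $\mathrm{wt}:\mathcal{B}\to\frac12\mathbb{Z}$ such that (C0) $F$ restricted to $F^{ -1}(\mathcal{B})$ is injective; (C1) $\varphi(b)=\varepsilon(b)+2\,\mathrm{wt}(b)$ for all $b\in\mathcal{B}$; (C2) $\mathrm{wt}(F b)=\mathrm{wt}(b)-1$ whenever $F b\ne 0$. Here $E:\mathcal{B}\to\mathcal{B}\cup\{0\}$ is the inverse of $F$ where defined and $0$ otherwise, $\varphi(b)=\max\{k: F^k b\ne 0\}$ and $\varepsilon(b)=\max\{k: E^k b\ne0\}$. The pair $(b,a)$ encodes the basis element $x^{r-b}y^{b}\wedge x^{r-a}y^{a}$ of $\Lambda^2\mathrm{Sym}^r\mathbb{C}^2$.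 -}

module Defs where

open import Data.Nat using (ℕ; zero; suc; _+_; _*_; _∸_; _≤_; _<_; _≤?_; _<?_)
open import Data.Nat.DivMod using (_%_)
open import Data.Integer as ℤ using (ℤ; +_; _-_)
open import Data.Maybe using (Maybe; just; nothing; _>>=_)
open import Data.Product using (Σ; ∃; ∃₂; _×_; _,_)
open import Relation.Binary.PropositionalEquality using (_≡_; _≢_)
open import Relation.Nullary using (yes; no)

-- Half-integers ½ℤ, represented by their double (an integer).
record ½ℤ : Set where
  constructor half
  field double : ℤ
open ½ℤ public

fromℤ : ℤ → ½ℤ
fromℤ n = half (n ℤ.+ n)

-- General crystals.  F : B → B ∪ {0} is modelled as  B → Maybe B
-- (nothing = 0).

FPow : {B : Set} → (B → Maybe B) → ℕ → B → Maybe B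
FPow F zero    b = just b
FPow F (suc k) b = FPow F k b >>= F

-- E^k b ≠ 0, where E is the inverse of F where defined:
-- there is b' with F^k b' = b.
EPowDefined : {B : Set} → (B → Maybe B) → ℕ → B → Set
EPowDefined {B} F k b = Σ B λ b' → FPow F k b' ≡ just b

IsMax : (ℕ → Set) → ℕ → Set
IsMax P n = P n × (∀ k → P k → k ≤ n)

IsPhi : {B : Set} → (B → Maybe B) → B → ℕ → Set
IsPhi F b = IsMax (λ k → FPow F k b ≢ nothing)

IsEps : {B : Set} → (B → Maybe B) → B → ℕ → Set
IsEps F b = IsMax (λ k → EPowDefined F k b)

record IsCrystal (B : Set) (F : B → Maybe B) (wt : B → ½ℤ) : Set where
  field
    C0 : ∀ x y → F x ≢ nothing → F x ≡ F y → x ≡ y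
    C1 : ∀ b → ∃₂ λ φ ε → IsPhi F b φ × IsEps F b ε
                          × (+ φ ≡ + ε ℤ.+ double (wt b))
    C2 : ∀ b b' → F b ≡ just b' → double (wt b') ≡ double (wt b) - + 2

F2 : ℕ × ℕ → ℕ × ℕ
F2 (b , a) with a % 2 Data.Nat.≟ b % 2
... | yes _ = (suc b , a)
... | no  _ = (b , suc a)

record Br (r : ℕ) : Set where
  constructor ⟨_,_∣_,_⟩
  field
    b : ℕ
    a : ℕ
    .b<a : b < a
    .a≤r : a ≤ r

Fr : (r : ℕ) → Br r → Maybe (Br r)
Fr r ⟨ b , a ∣ _ , _ ⟩ with F2 (b , a)
... | (b' , a') with b' <? a' | a' ≤? r
...   | yes p | yes q = just ⟨ b' , a' ∣ p , q ⟩
...   | _     | _     = nothing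

wtr : (r : ℕ) → Br r → ½ℤ
wtr r ⟨ b , a ∣ _ , _ ⟩ = fromℤ (+ r - + a - + b)

{-# OPTIONS --safe #-}
module Submission where

open import Defs
open import Data.Nat using (ℕ; zero; suc; pred; _+_; _*_; _∸_; _≤_; _<_; _≟_; _≤?_; _<?_; s≤s; s≤s⁻¹; z≤n)
open import Data.Nat.DivMod using (_%_)
open import Data.Nat.Properties
  using (suc-injective; 0≢1+n; 1+n≢0; n≤1+n; ≤-trans; <-trans; n<1+n; ≮⇒≥; m≤n⇒m<n∨m≡n;
         m≤n⇒m∸n≡0; +-∸-assoc; *-suc)
open import Data.Integer as ℤ using (ℤ; +_; _-_)
open import Data.Integer.Properties using (pos-+; pos-*; m-n≡m⊖n; ⊖-≥)
open import Data.Integer.Tactic.RingSolver using (solve-∀)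
open import Data.Maybe using (Maybe; just; nothing; _>>=_)
open import Data.Maybe.Properties using (just-injective)
open import Data.Product using (∃; _×_; _,_; proj₁; proj₂)
open import Data.Sum using (inj₁; inj₂)
open import Function using (_∘_)
open import Relation.Nullary using (¬_; yes; no; contradiction)
open import Relation.Nullary.Decidable using (recompute)
open import Relation.Binary.PropositionalEquality
open ≡-Reasoning

-- F raises b and a in turn: a step from (b , a) raises b when a ≡ b (mod 2) and a otherwise, and
-- either way flips that parity condition. So along an F-string a + b grows by one per step, and
--   φ (b , a) = [a ≡ b] + 2 (r ∸ a)      ε (b , a) = [a ≡ b] + 2 b
-- count the steps F_r can still take from (b , a) and the steps back to the start of its string;
-- their difference is 2 (r - a - b) = 2 wt. F is injective because the parity of F t tells which
-- coordinate was raised.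

module _ {B : Set} (F : B → Maybe B) where

  InjectiveOnDomain : Set
  InjectiveOnDomain = ∀ {x y z} → F x ≡ just z → F y ≡ just z → x ≡ y

  cancel-defined : InjectiveOnDomain → ∀ x y → F x ≢ nothing → F x ≡ F y → x ≡ y
  cancel-defined injective x y Fx≢0 Fx≡Fy with F x in Fx
  ... | just z  = injective Fx (sym Fx≡Fy)
  ... | nothing = contradiction refl Fx≢0

  FPow-suc : ∀ k b → FPow F (suc k) b ≡ (F b >>= FPow F k)
  FPow-suc zero    b with F b
  ... | nothing = refl
  ... | just _  = refl
  FPow-suc (suc k) b = trans (cong (_>>= F) (FPow-suc k b)) (>>=-assoc (F b))
    where
      >>=-assoc : ∀ mb → ((mb >>= FPow F k) >>= F) ≡ (mb >>= FPow F (suc k))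
      >>=-assoc nothing  = refl
      >>=-assoc (just _) = refl

  EPowDefined-suc : ∀ {k b} → EPowDefined F (suc k) b → ∃ λ c → EPowDefined F k c × F c ≡ just b
  EPowDefined-suc {k} (x , _) with FPow F k x in FPow≡c
  EPowDefined-suc (x , Fc≡b) | just c = c , (x , FPow≡c) , Fc≡b
  EPowDefined-suc (x , ())   | nothing

  isPhi-zero : ∀ {b} → F b ≡ nothing → IsPhi F b 0
  isPhi-zero {b} Fb≡0 = (λ ()) , bounded
    where
      bounded : ∀ k → FPow F k b ≢ nothing → k ≤ 0
      bounded zero    _  = z≤n
      bounded (suc k) ≢0 = contradiction (trans (FPow-suc k b) (cong (_>>= FPow F k) Fb≡0)) ≢0

  isPhi-suc : ∀ {b b' n} → F b ≡ just b' → IsPhi F b' n → IsPhi F b (suc n)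
  isPhi-suc {b} {b'} {n} Fb≡b' (defined , bounded) = subst (_≢ nothing) (sym (shift n)) defined , bounded'
    where
      shift : ∀ k → FPow F (suc k) b ≡ FPow F k b'
      shift k = trans (FPow-suc k b) (cong (_>>= FPow F k) Fb≡b')
      bounded' : ∀ k → FPow F k b ≢ nothing → k ≤ suc n
      bounded' zero    _  = z≤n
      bounded' (suc k) ≢0 = s≤s (bounded k (subst (_≢ nothing) (shift k) ≢0))

  isEps-zero : ∀ {b} → (∀ x → F x ≢ just b) → IsEps F b 0
  isEps-zero {b} noPreimage = (b , refl) , bounded
    where
      bounded : ∀ k → EPowDefined F k b → k ≤ 0
      bounded zero    _ = z≤n
      bounded (suc k) d = let c , _ , Fc≡b = EPowDefined-suc {k} d in contradiction Fc≡b (noPreimage c)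

  isEps-suc : InjectiveOnDomain →
              ∀ {b c n} → F c ≡ just b → IsEps F c n → IsEps F b (suc n)
  isEps-suc injective {b} {c} {n} Fc≡b ((x , FPow≡c) , bounded) =
    (x , trans (cong (_>>= F) FPow≡c) Fc≡b) , bounded'
    where
      bounded' : ∀ k → EPowDefined F k b → k ≤ suc n
      bounded' zero    _ = z≤n
      bounded' (suc k) d = let c' , d' , Fc'≡b = EPowDefined-suc {k} d
                           in s≤s (bounded k (subst (EPowDefined F k) (injective Fc'≡b Fc≡b) d'))

  isPhi-from-potential : (φ : B → ℕ) →
                         (∀ b b' → F b ≡ just b' → φ b ≡ suc (φ b')) →
                         (∀ b → F b ≡ nothing → φ b ≡ 0) →
                         ∀ b → IsPhi F b (φ b)
  isPhi-from-potential φ step stop b = go (φ b) b refl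
    where
      go : ∀ n b → φ b ≡ n → IsPhi F b n
      go n b φb≡n with F b in Fb
      go zero    b φb≡0   | nothing = isPhi-zero Fb
      go (suc n) b φb≡1+n | nothing = contradiction (trans (sym (stop b Fb)) φb≡1+n) 0≢1+n
      go zero    b φb≡0   | just b' = contradiction (trans (sym (step b b' Fb)) φb≡0) 1+n≢0
      go (suc n) b φb≡1+n | just b' =
        isPhi-suc Fb (go n b' (suc-injective (trans (sym (step b b' Fb)) φb≡1+n)))

  isEps-from-potential : InjectiveOnDomain →
                         (ε : B → ℕ) →
                         (∀ b b' → F b ≡ just b' → ε b' ≡ suc (ε b)) →
                         (∀ b {m} → ε b ≡ suc m → ∃ λ x → F x ≡ just b) →
                         ∀ b → IsEps F b (ε b)
  isEps-from-potential injective ε step preimage b = go (ε b) b refl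
    where
      go : ∀ n b → ε b ≡ n → IsEps F b n
      go zero    b εb≡0   = isEps-zero λ x Fx≡b → 1+n≢0 (trans (sym (step x b Fx≡b)) εb≡0)
      go (suc n) b εb≡1+n =
        let x , Fx≡b = preimage b εb≡1+n
        in isEps-suc injective Fx≡b (go n x (suc-injective (trans (sym (step x b Fx≡b)) εb≡1+n)))

[1+n]%2≢n%2 : ∀ n → suc n % 2 ≢ n % 2
[1+n]%2≢n%2 zero          ()
[1+n]%2≢n%2 (suc zero)    ()
[1+n]%2≢n%2 (suc (suc n)) = [1+n]%2≢n%2 n

m%2≢n%2⇒[1+m]%2≡n%2 : ∀ m n → m % 2 ≢ n % 2 → suc m % 2 ≡ n % 2
m%2≢n%2⇒[1+m]%2≡n%2 zero          zero          ≢ = contradiction refl ≢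
m%2≢n%2⇒[1+m]%2≡n%2 zero          (suc zero)    _ = refl
m%2≢n%2⇒[1+m]%2≡n%2 (suc zero)    zero          _ = refl
m%2≢n%2⇒[1+m]%2≡n%2 (suc zero)    (suc zero)    ≢ = contradiction refl ≢
m%2≢n%2⇒[1+m]%2≡n%2 m             (suc (suc n)) ≢ = m%2≢n%2⇒[1+m]%2≡n%2 m n ≢
m%2≢n%2⇒[1+m]%2≡n%2 (suc (suc m)) n             ≢ = m%2≢n%2⇒[1+m]%2≡n%2 m n ≢

m%2≡n%2⇒m%2≢[1+n]%2 : ∀ m n → m % 2 ≡ n % 2 → m % 2 ≢ suc n % 2
m%2≡n%2⇒m%2≢[1+n]%2 m n m≡n m≡1+n = [1+n]%2≢n%2 n (trans (sym m≡1+n) m≡n)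

m<n∧n%2≡m%2⇒1+m<n : ∀ m n → m < n → n % 2 ≡ m % 2 → suc m < n
m<n∧n%2≡m%2⇒1+m<n m n m<n n≡m with m≤n⇒m<n∨m≡n m<n
... | inj₁ 1+m<n = 1+m<n
... | inj₂ refl  = contradiction n≡m ([1+n]%2≢n%2 m)

-- Branches on the same test as F2, so one `with a % 2 ≟ b % 2` unfolds F2 and byParity together.
byParity : {X : Set} → ℕ × ℕ → X → X → X
byParity (b , a) x y with a % 2 ≟ b % 2
... | yes _ = x
... | no  _ = y

byParity-≡ : ∀ {X : Set} {x y : X} b a → a % 2 ≡ b % 2 → byParity (b , a) x y ≡ x
byParity-≡ b a a≡b with a % 2 ≟ b % 2
... | yes _   = refl
... | no  a≢b = contradiction a≡b a≢b

byParity-≢ : ∀ {X : Set} {x y : X} b a → a % 2 ≢ b % 2 → byParity (b , a) x y ≡ y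
byParity-≢ b a a≢b with a % 2 ≟ b % 2
... | yes a≡b = contradiction a≡b a≢b
... | no  _   = refl

F2-≡ : ∀ b a → a % 2 ≡ b % 2 → F2 (b , a) ≡ (suc b , a)
F2-≡ b a a≡b with a % 2 ≟ b % 2
... | yes _   = refl
... | no  a≢b = contradiction a≡b a≢b

F2-≢ : ∀ b a → a % 2 ≢ b % 2 → F2 (b , a) ≡ (b , suc a)
F2-≢ b a a≢b with a % 2 ≟ b % 2
... | yes a≡b = contradiction a≡b a≢b
... | no  _   = refl

E2 : ℕ × ℕ → ℕ × ℕ
E2 p@(b , a) = byParity p (b , pred a) (pred b , a)

parityBit : ℕ × ℕ → ℕ
parityBit p = byParity p 1 0

φ2 : ℕ → ℕ × ℕ → ℕ
φ2 r p@(_ , a) = parityBit p + 2 * (r ∸ a)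

ε2 : ℕ × ℕ → ℕ
ε2 p@(b , _) = parityBit p + 2 * b

wt2 : ℕ → ℕ × ℕ → ℤ
wt2 r (b , a) = + r - + a - + b

InB : ℕ → ℕ × ℕ → Set
InB r (b , a) = b < a × a ≤ r

parityBit-≡ : ∀ b a → a % 2 ≡ b % 2 → parityBit (b , a) ≡ 1
parityBit-≡ = byParity-≡

parityBit-≢ : ∀ b a → a % 2 ≢ b % 2 → parityBit (b , a) ≡ 0
parityBit-≢ = byParity-≢

E2-F2 : ∀ p → E2 (F2 p) ≡ p
E2-F2 (b , a) with a % 2 ≟ b % 2
... | yes a≡b = byParity-≢ (suc b) a (m%2≡n%2⇒m%2≢[1+n]%2 a b a≡b)
... | no  a≢b = byParity-≡ b (suc a) (m%2≢n%2⇒[1+m]%2≡n%2 a b a≢b)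

ε2-F2 : ∀ p → ε2 (F2 p) ≡ suc (ε2 p)
ε2-F2 (b , a) with a % 2 ≟ b % 2
... | yes a≡b = cong₂ _+_ (parityBit-≢ (suc b) a (m%2≡n%2⇒m%2≢[1+n]%2 a b a≡b)) (*-suc 2 b)
... | no  a≢b = cong (_+ 2 * b) (parityBit-≡ b (suc a) (m%2≢n%2⇒[1+m]%2≡n%2 a b a≢b))

φ2-F2 : ∀ r p → InB r (F2 p) → φ2 r p ≡ suc (φ2 r (F2 p))
φ2-F2 r (b , a) F2p∈B with a % 2 ≟ b % 2
... | yes a≡b =
  cong (λ i → suc (i + 2 * (r ∸ a))) (sym (parityBit-≢ (suc b) a (m%2≡n%2⇒m%2≢[1+n]%2 a b a≡b)))
... | no  a≢b = begin
  2 * (r ∸ a)                                    ≡⟨ cong (2 *_) (+-∸-assoc 1 (proj₂ F2p∈B)) ⟩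
  2 * suc (r ∸ suc a)                            ≡⟨ *-suc 2 (r ∸ suc a) ⟩
  suc (1 + 2 * (r ∸ suc a))                      ≡⟨ cong (λ i → suc (i + 2 * (r ∸ suc a))) 1≡bit ⟩
  suc (parityBit (b , suc a) + 2 * (r ∸ suc a))  ∎
  where
    1≡bit = sym (parityBit-≡ b (suc a) (m%2≢n%2⇒[1+m]%2≡n%2 a b a≢b))

φ2-exit : ∀ r p → InB r p → ¬ InB r (F2 p) → φ2 r p ≡ 0
φ2-exit r (b , a) (b<a , a≤r) F2p∉B with a % 2 ≟ b % 2
... | yes a≡b = contradiction (m<n∧n%2≡m%2⇒1+m<n b a b<a a≡b , a≤r) F2p∉B
... | no  _   = cong (2 *_) (m≤n⇒m∸n≡0 (≮⇒≥ λ a<r → F2p∉B (<-trans b<a (n<1+n a) , a<r)))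

E2-preimage : ∀ r p {m} → InB r p → ε2 p ≡ suc m → InB r (E2 p) × F2 (E2 p) ≡ p
E2-preimage r (b , a) (b<a , a≤r) ε≡1+m with a % 2 ≟ b % 2
E2-preimage r (b , zero)  (() , _)           _  | yes _
E2-preimage r (b , suc a) (b<1+a , 1+a≤r)    _  | yes 1+a≡b =
  (s≤s⁻¹ (m<n∧n%2≡m%2⇒1+m<n b (suc a) b<1+a 1+a≡b) , ≤-trans (n≤1+n a) 1+a≤r) ,
  F2-≢ b a (λ a≡b → [1+n]%2≢n%2 a (trans 1+a≡b (sym a≡b)))
E2-preimage r (zero , a)  _                  () | no  _
E2-preimage r (suc b , a) (1+b<a , a≤r)      _  | no  a≢1+b =
  (<-trans (n<1+n b) 1+b<a , a≤r) ,
  F2-≡ b a (sym (m%2≢n%2⇒[1+m]%2≡n%2 (suc b) a (≢-sym a≢1+b)))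

wt2-F2 : ∀ r p → wt2 r (F2 p) ≡ wt2 r p - + 1
wt2-F2 r (b , a) with a % 2 ≟ b % 2
... | yes _ = subtract-suc-last (+ r) (+ a) (+ b)
  where
    subtract-suc-last : ∀ x y z → x - y - (+ 1 ℤ.+ z) ≡ x - y - z - + 1
    subtract-suc-last = solve-∀
... | no  _ = subtract-suc-middle (+ r) (+ a) (+ b)
  where
    subtract-suc-middle : ∀ x y z → x - (+ 1 ℤ.+ y) - z ≡ x - y - z - + 1
    subtract-suc-middle = solve-∀

double-fromℤ-pred : ∀ x → double (fromℤ (x - + 1)) ≡ double (fromℤ x) - + 2
double-fromℤ-pred = twice-pred
  where
    twice-pred : ∀ x → (x - + 1) ℤ.+ (x - + 1) ≡ (x ℤ.+ x) - + 2
    twice-pred = solve-∀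

φ2≡ε2+2wt2 : ∀ r p → InB r p → + φ2 r p ≡ + ε2 p ℤ.+ double (fromℤ (wt2 r p))
φ2≡ε2+2wt2 r (b , a) (_ , a≤r) = begin
  + (i + 2 * (r ∸ a))                         ≡⟨ pos-i+2n i (r ∸ a) ⟩
  + i ℤ.+ + 2 ℤ.* + (r ∸ a)                   ≡⟨ cong (λ d → + i ℤ.+ + 2 ℤ.* d) r∸a ⟩
  + i ℤ.+ + 2 ℤ.* (+ r - + a)                 ≡⟨ regroup (+ i) (+ r) (+ a) (+ b) ⟩
  (+ i ℤ.+ + 2 ℤ.* + b) ℤ.+ double (fromℤ w) ≡⟨ cong (ℤ._+ double (fromℤ w)) (sym (pos-i+2n i b)) ⟩
  + (i + 2 * b) ℤ.+ double (fromℤ w)          ∎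
  where
    i = parityBit (b , a)
    w = wt2 r (b , a)
    pos-i+2n : ∀ i n → + (i + 2 * n) ≡ + i ℤ.+ + 2 ℤ.* + n
    pos-i+2n i n = trans (pos-+ i (2 * n)) (cong (ℤ._+_ (+ i)) (pos-* 2 n))
    r∸a : + (r ∸ a) ≡ + r - + a
    r∸a = sym (trans (m-n≡m⊖n r a) (⊖-≥ a≤r))
    regroup : ∀ i x y z → i ℤ.+ + 2 ℤ.* (x - y) ≡ (i ℤ.+ + 2 ℤ.* z) ℤ.+ ((x - y - z) ℤ.+ (x - y - z))
    regroup = solve-∀

module BrCrystal (r : ℕ) where

  coords : Br r → ℕ × ℕ
  coords ⟨ b , a ∣ _ , _ ⟩ = b , a

  coords-injective : ∀ {x y} → coords x ≡ coords y → x ≡ y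
  coords-injective {⟨ _ , _ ∣ _ , _ ⟩} {⟨ _ , _ ∣ _ , _ ⟩} refl = refl

  coords∈B : ∀ t → InB r (coords t)
  coords∈B ⟨ b , a ∣ b<a , a≤r ⟩ = recompute (b <? a) b<a , recompute (a ≤? r) a≤r

  fromInB : ∀ {p} → InB r p → Br r
  fromInB {p} (b<a , a≤r) = ⟨ proj₁ p , proj₂ p ∣ b<a , a≤r ⟩

  Fr-just : ∀ t {t'} → Fr r t ≡ just t' → coords t' ≡ F2 (coords t)
  Fr-just ⟨ b , a ∣ _ , _ ⟩ eq with F2 (b , a)
  ... | b' , a' with b' <? a' | a' ≤? r
  ...   | yes _ | yes _ = cong coords (sym (just-injective eq))
  ...   | yes _ | no  _ = contradiction eq λ ()
  ...   | no  _ | _     = contradiction eq λ ()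

  Fr-nothing : ∀ t → Fr r t ≡ nothing → ¬ InB r (F2 (coords t))
  Fr-nothing ⟨ b , a ∣ _ , _ ⟩ eq with F2 (b , a)
  ... | b' , a' with b' <? a' | a' ≤? r
  ...   | yes _    | yes _    = contradiction eq λ ()
  ...   | yes _    | no  a'≰r = a'≰r ∘ proj₂
  ...   | no  b'≮a' | _       = b'≮a' ∘ proj₁

  Fr-≡just : ∀ x t → F2 (coords x) ≡ coords t → Fr r x ≡ just t
  Fr-≡just x t F2x≡t with Fr r x in eq
  ... | just t' = cong just (coords-injective (trans (Fr-just x eq) F2x≡t))
  ... | nothing = contradiction (subst (InB r) (sym F2x≡t) (coords∈B t)) (Fr-nothing x eq)

  Fr-injective : InjectiveOnDomain (Fr r)
  Fr-injective {x} {y} {z} Fx≡z Fy≡z = coords-injective (begin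
    coords x             ≡⟨ E2-F2 (coords x) ⟨
    E2 (F2 (coords x))   ≡⟨ cong E2 (Fr-just x Fx≡z) ⟨
    E2 (coords z)        ≡⟨ cong E2 (Fr-just y Fy≡z) ⟩
    E2 (F2 (coords y))   ≡⟨ E2-F2 (coords y) ⟩
    coords y             ∎)

  φ : Br r → ℕ
  φ = φ2 r ∘ coords

  ε : Br r → ℕ
  ε = ε2 ∘ coords

  φ-step : ∀ t t' → Fr r t ≡ just t' → φ t ≡ suc (φ t')
  φ-step t t' eq = begin
    φ t                          ≡⟨ φ2-F2 r (coords t) (subst (InB r) (Fr-just t eq) (coords∈B t')) ⟩
    suc (φ2 r (F2 (coords t)))   ≡⟨ cong (suc ∘ φ2 r) (Fr-just t eq) ⟨
    suc (φ t')                   ∎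

  φ-stop : ∀ t → Fr r t ≡ nothing → φ t ≡ 0
  φ-stop t eq = φ2-exit r (coords t) (coords∈B t) (Fr-nothing t eq)

  ε-step : ∀ t t' → Fr r t ≡ just t' → ε t' ≡ suc (ε t)
  ε-step t _ eq = trans (cong ε2 (Fr-just t eq)) (ε2-F2 (coords t))

  ε-preimage : ∀ t {m} → ε t ≡ suc m → ∃ λ x → Fr r x ≡ just t
  ε-preimage t εt≡1+m =
    let E2t∈B , F2E2t≡t = E2-preimage r (coords t) (coords∈B t) εt≡1+m
    in fromInB E2t∈B , Fr-≡just (fromInB E2t∈B) t F2E2t≡t

  wt-step : ∀ t t' → Fr r t ≡ just t' → double (wtr r t') ≡ double (wtr r t) - + 2
  wt-step t t' eq = begin
    double (wtr r t')                        ≡⟨ cong (double ∘ fromℤ ∘ wt2 r) (Fr-just t eq) ⟩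
    double (fromℤ (wt2 r (F2 (coords t))))   ≡⟨ cong (double ∘ fromℤ) (wt2-F2 r (coords t)) ⟩
    double (fromℤ (wt2 r (coords t) - + 1))  ≡⟨ double-fromℤ-pred (wt2 r (coords t)) ⟩
    double (wtr r t) - + 2                   ∎

  φ≡ε+2wt : ∀ t → + φ t ≡ + ε t ℤ.+ double (wtr r t)
  φ≡ε+2wt t = φ2≡ε2+2wt2 r (coords t) (coords∈B t)

proposition5p1 : (r : ℕ) → 2 ≤ r → IsCrystal (Br r) (Fr r) (wtr r)
proposition5p1 r _ = record
  { C0 = cancel-defined (Fr r) Fr-injective
  ; C1 = λ t → φ t , ε t
             , isPhi-from-potential (Fr r) φ φ-step φ-stop t
             , isEps-from-potential (Fr r) Fr-injective ε ε-step ε-preimage t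
             , φ≡ε+2wt t
  ; C2 = wt-step
  }
  where open BrCrystal r
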